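{- Let $u$ be an earmarked word of length at least $8$. Let $w$ be the word obtained from $\mu(u)$ by complementing its first and last letters. Then $w$ is both earmarked and extremal overlap-free.
   Context: Words are over $\Sigma_2=\{\mathtt{0},\mathtt{1}\}$. $\mu$ is the Thue–Morse morphism $\mu(\mathtt{0})=\mathtt{01}$, $\mu(\mathtt{1})=\mathtt{10}$. An overlap is a word $axaxa$ with $a$ a letter, $x$ possibly empty; a word is overlap-free if it has no overlap as a factor. A word $w\in\Sigma_2^*$ is earmarked if it is overlap-free, its length-4 prefix is in $\{\mathtt{0010},\mathtt{1101}\}$, and its length-4 suffix is $\mathtt{0100}$. An extension of $w$ is a word $w'aw''$ with $a\in\Sigma_2$ and $w'w''=w$; $w$ is extremal overlap-free if it is overlap-free and every extension contains an overlap. -}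

module Defs where

open import Data.Bool using (Bool; true; false; not)
open import Data.List using (List; []; _∷_; _++_; length)
open import Data.Product using (Σ; ∃; ∃-syntax; _×_; _,_)
open import Data.Sum using (_⊎_)
open import Data.Nat using (ℕ; _≤_)
open import Relation.Binary.PropositionalEquality using (_≡_)
open import Relation.Nullary using (¬_)

Letter : Set
Letter = Bool

Word : Set
Word = List Letter

𝟎 𝟏 : Letter
𝟎 = false
𝟏 = true

μ : Word → Word
μ []       = []
μ (a ∷ w)  = a ∷ not a ∷ μ w

Factor : Word → Word → Set
Factor f w = ∃[ p ] ∃[ s ] (p ++ f ++ s ≡ w)

IsOverlap : Word → Set
IsOverlap v = ∃[ a ] ∃[ x ] (v ≡ a ∷ x ++ a ∷ x ++ a ∷ [])

HasOverlap : Word → Set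
HasOverlap w = ∃[ v ] (IsOverlap v × Factor v w)

OverlapFree : Word → Set
OverlapFree w = ¬ HasOverlap w

HasPrefix : Word → Word → Set
HasPrefix p w = ∃[ r ] (w ≡ p ++ r)

HasSuffix : Word → Word → Set
HasSuffix s w = ∃[ r ] (w ≡ r ++ s)

Earmarked : Word → Set
Earmarked w =
  OverlapFree w
  × (HasPrefix (𝟎 ∷ 𝟎 ∷ 𝟏 ∷ 𝟎 ∷ []) w ⊎ HasPrefix (𝟏 ∷ 𝟏 ∷ 𝟎 ∷ 𝟏 ∷ []) w)
  × HasSuffix (𝟎 ∷ 𝟏 ∷ 𝟎 ∷ 𝟎 ∷ []) w

ExtremalOverlapFree : Word → Set
ExtremalOverlapFree w =
  OverlapFree w
  × (∀ (w' w'' : Word) (a : Letter) → w' ++ w'' ≡ w → HasOverlap (w' ++ a ∷ w''))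

-- complement the first and last letters of a word
-- (used on μ(u), which has length ≥ 2)
flipLast : Word → Word
flipLast []           = []
flipLast (a ∷ [])     = not a ∷ []
flipLast (a ∷ b ∷ w)  = a ∷ flipLast (b ∷ w)

flipFirst : Word → Word
flipFirst []       = []
flipFirst (a ∷ w)  = not a ∷ w

flipEnds : Word → Word
flipEnds w = flipFirst (flipLast w)

module Submission where

-- μ(u) is overlap-free because u is: the aligned pairs (2k, 2k+1) of μ(u) consist of different
-- letters, so an odd period would make a whole window alternate, and an even period 2π can be moved
-- to an even start and then read off as an overlap of period π in u.
--
-- Flipping the two end letters of μ(u) only affects overlaps that touch an end. For either admissible
-- prefix of u, flipEnds(μ(u)) begins with a a ¬a a a ¬a ¬a, which together with the alternation of
-- the aligned pairs excludes every overlap at the start; the suffix 0100 makes the last seven letters,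
-- read backwards, follow the same pattern, so the same argument applies to the reversed word.
--
-- Extremality is a finite check. An insertion lies at position ≤ 7 of the image of the first seven
-- letters of u, at position ≥ 6 of the image of the last seven letters, or at position 6 or 7 of the
-- image of some other block of seven consecutive letters; in each case an exhaustive search over the
-- possible blocks finds an overlap created inside that image.

open import Defs
open import Data.Bool using (Bool; true; false; not; T)
open import Data.Bool.Properties using (_≟_; not-involutive; not-¬)
open import Data.Empty using (⊥; ⊥-elim)
open import Data.List.Base using (List; []; _∷_; _++_; length; take; drop; map; inits; tails; upTo; applyUpTo)
open import Data.List.Properties using (++-assoc; ++-identityʳ; length-++; take++drop≡id; ∷-injective)
open import Data.List.Membership.Propositional using (_∈_)
open import Data.List.Membership.Propositional.Properties using (∈-++⁺ˡ; ∈-++⁺ʳ; ∈-map⁺; ∈-upTo⁺; ∈-applyUpTo⁺)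
open import Data.List.Relation.Unary.Any using (Any; here; there; any?; satisfied)
open import Data.List.Relation.Unary.All using (All; all?; lookup)
open import Data.List.Relation.Binary.Prefix.Heterogeneous using (Prefix; []; _∷_)
open import Data.List.Relation.Binary.Prefix.Heterogeneous.Properties using (prefix?)
open import Data.Nat.Base using (ℕ; zero; suc; _+_; _∸_; _≤_; _<_; _≤ᵇ_; z≤n; s≤s)
open import Data.Nat.Properties
  using ( +-suc; +-assoc; +-comm; +-identityʳ; +-cancelˡ-≡; +-cancelˡ-≤; +-cancelʳ-≤; +-mono-≤; +-monoʳ-≤
        ; +-monoʳ-<; +-mono-≤-<; ≤-refl; ≤-reflexive; ≤-trans; ≤-<-trans; <-trans; <-irrefl; ≤-pred
        ; <⇒≤; <⇒≱; ≰⇒>; n≤1+n; n<1+n; m≤m+n; m≤n+m; m+n≤o⇒m≤o; m+n≤o⇒n≤o; m≤n⇒m<n∨m≡n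
        ; m≤n⇒∃[o]m+o≡n; m+n∸n≡m; +-∸-assoc; ≤ᵇ⇒≤; _≤?_; suc-injective; module ≤-Reasoning )
open import Data.Nat.Tactic.RingSolver using (solve-∀)
open import Data.Product using (∃-syntax; _×_; _,_)
open import Data.Sum using (_⊎_; inj₁; inj₂)
open import Function using (_∘_; id)
open import Relation.Binary.PropositionalEquality
  using (_≡_; refl; sym; trans; cong; cong₂; subst; subst₂; module ≡-Reasoning)
open import Relation.Nullary using (¬_; yes; no)
open import Relation.Nullary.Decidable using (from-yes; _×-dec_)
open import Relation.Unary using (Decidable)

parity : ∀ n → (∃[ k ] n ≡ k + k) ⊎ (∃[ k ] n ≡ suc (k + k))
parity zero = inj₁ (0 , refl)
parity (suc n) with parity n
... | inj₁ (k , refl) = inj₂ (k , refl)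
... | inj₂ (k , refl) = inj₁ (suc k , cong suc (sym (+-suc k k)))

m+m<n+n⇒m<n : ∀ {m n} → m + m < n + n → m < n
m+m<n+n⇒m<n 2m<2n = ≰⇒> (λ n≤m → <⇒≱ 2m<2n (+-mono-≤ n≤m n≤m))

m+m≤1+n+n⇒m≤n : ∀ {m n} → m + m ≤ suc (n + n) → m ≤ n
m+m≤1+n+n⇒m≤n {m} {n} 2m≤2n+1 =
  ≤-pred (m+m<n+n⇒m<n (subst (m + m <_) (cong suc (sym (+-suc n n))) (s≤s 2m≤2n+1)))

not-sym : ∀ {x y} → x ≡ not y → y ≡ not x
not-sym {x} {y} x≡¬y = trans (sym (not-involutive y)) (cong not (sym x≡¬y))

alternating-odd : ∀ (f : ℕ → Bool) k → (∀ j → j < suc (k + k) → f (suc j) ≡ not (f j)) →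
  f (suc (k + k)) ≡ not (f 0)
alternating-odd f zero    alt = alt 0 (s≤s z≤n)
alternating-odd f (suc k) alt = begin
  f (suc (suc k + suc k))  ≡⟨ cong (λ n → f (suc (suc n))) (+-suc k k) ⟩
  f (suc (suc m))          ≡⟨ alt (suc m) 1+m<n ⟩
  not (f (suc m))          ≡⟨ cong not (alt m (<⇒≤ 1+m<n)) ⟩
  not (not (f m))          ≡⟨ not-involutive (f m) ⟩
  f m                      ≡⟨ alternating-odd f k (λ j j<m → alt j (≤-trans j<m (≤-trans (n≤1+n m) (<⇒≤ 1+m<n)))) ⟩
  not (f 0)                ∎
  where
  open ≡-Reasoning
  m = suc (k + k)
  1+m<n : suc m < suc (suc k + suc k)
  1+m<n = s≤s (s≤s (≤-reflexive (sym (+-suc k k))))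

-- Overlaps as periodic windows

-- Positions past the end of a word read as 𝟎.
at : Word → ℕ → Letter
at []      _       = 𝟎
at (a ∷ w) zero    = a
at (a ∷ w) (suc i) = at w i

at-++ˡ : ∀ (v : Word) {w i} → i < length v → at (v ++ w) i ≡ at v i
at-++ˡ (a ∷ v) {i = zero}  _         = refl
at-++ˡ (a ∷ v) {i = suc i} (s≤s i<v) = at-++ˡ v i<v

at-++ʳ : ∀ (v : Word) {w} i → at (v ++ w) (length v + i) ≡ at w i
at-++ʳ []      i = refl
at-++ʳ (a ∷ v) i = at-++ʳ v i

at-infix : ∀ (p v s : Word) {i} → i < length v → at (p ++ v ++ s) (length p + i) ≡ at v i
at-infix p v s i<v = trans (at-++ʳ p _) (at-++ˡ v i<v)

at-drop : ∀ n (w : Word) i → at (drop n w) i ≡ at w (n + i)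
at-drop zero    w       i = refl
at-drop (suc n) []      i = refl
at-drop (suc n) (a ∷ w) i = at-drop n w i

length-drop-≥ : ∀ n {k} (w : Word) → n + k ≤ length w → k ≤ length (drop n w)
length-drop-≥ zero    w       k≤w       = k≤w
length-drop-≥ (suc n) (a ∷ w) (s≤s k≤w) = length-drop-≥ n w k≤w

take-pointwise : ∀ n (v w : Word) → n ≤ length v → n ≤ length w →
  (∀ i → i < n → at v i ≡ at w i) → take n v ≡ take n w
take-pointwise zero    v       w       _         _         _  = refl
take-pointwise (suc n) (a ∷ v) (b ∷ w) (s≤s n≤v) (s≤s n≤w) eq =
  cong₂ _∷_ (eq 0 (s≤s z≤n)) (take-pointwise n v w n≤v n≤w (λ i i<n → eq (suc i) (s≤s i<n)))

head-tail : ∀ (w : Word) → 0 < length w → w ≡ at w 0 ∷ drop 1 w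
head-tail (a ∷ w) _ = refl

Periodic : (ℕ → Letter) → ℕ → ℕ → Set
Periodic f s p = ∀ j → j ≤ p → f (s + j) ≡ f (s + (p + j))

-- An overlap a x a x a at position s is a window s … s + 2p of period p = length (a ∷ x).
record Overlap (w : Word) : Set where
  constructor overlapAt
  field
    start period : ℕ
    period>0     : 0 < period
    fits         : start + (period + period) < length w
    periodic     : Periodic (at w) start period

overlapWord : Letter → Word → Word
overlapWord a x = a ∷ x ++ a ∷ x ++ a ∷ []

length-overlapWord : ∀ a x → length (overlapWord a x) ≡ suc (suc (length x) + suc (length x))
length-overlapWord a x = begin
  length (a ∷ x ++ a ∷ x ++ a ∷ [])           ≡⟨ cong suc (length-++ x) ⟩
  suc (length x + suc (length (x ++ a ∷ []))) ≡⟨ cong (λ n → suc (length x + suc n)) (length-++ x) ⟩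
  suc (length x + suc (length x + 1))         ≡⟨ cong suc (lemma (length x)) ⟩
  suc (suc (length x) + suc (length x))       ∎
  where
  open ≡-Reasoning
  lemma : ∀ n → n + suc (n + 1) ≡ suc n + suc n
  lemma = solve-∀

overlapWord-periodic : ∀ a x → Periodic (at (overlapWord a x)) 0 (suc (length x))
overlapWord-periodic a x j j≤p = begin
  at (overlapWord a x) j                    ≡⟨ cong (λ v → at (a ∷ v) j) (sym (++-assoc x (a ∷ []) (x ++ a ∷ []))) ⟩
  at ((a ∷ x ++ a ∷ []) ++ x ++ a ∷ []) j   ≡⟨ at-++ˡ (a ∷ x ++ a ∷ []) j<|ax++a| ⟩
  at (a ∷ x ++ a ∷ []) j                    ≡⟨ sym (at-++ʳ (a ∷ x) j) ⟩
  at (overlapWord a x) (suc (length x) + j) ∎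
  where
  open ≡-Reasoning
  j<|ax++a| : j < length (a ∷ x ++ a ∷ [])
  j<|ax++a| = s≤s (subst (j ≤_) (trans (+-comm 1 (length x)) (sym (length-++ x))) j≤p)

HasOverlap⇒Overlap : ∀ {w} → HasOverlap w → Overlap w
HasOverlap⇒Overlap (_ , (a , x , refl) , p , s , refl) = overlapAt (length p) period (s≤s z≤n) fits periodic
  where
  period = suc (length x)
  v = overlapWord a x
  inside : ∀ {i} → i ≤ period + period → i < length v
  inside {i} i≤2p = subst (i <_) (sym (length-overlapWord a x)) (s≤s i≤2p)
  fits : length p + (period + period) < length (p ++ v ++ s)
  fits = begin-strict
    length p + (period + period)      <⟨ +-monoʳ-< (length p) (inside ≤-refl) ⟩
    length p + length v               ≤⟨ +-monoʳ-≤ (length p) (m≤m+n (length v) (length s)) ⟩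
    length p + (length v + length s)  ≡⟨ cong (length p +_) (sym (length-++ v)) ⟩
    length p + length (v ++ s)        ≡⟨ sym (length-++ p) ⟩
    length (p ++ v ++ s)              ∎
    where open ≤-Reasoning
  periodic : Periodic (at (p ++ v ++ s)) (length p) period
  periodic j j≤p = begin
    at (p ++ v ++ s) (length p + j)            ≡⟨ at-infix p v s (inside (≤-trans j≤p (m≤n+m period period))) ⟩
    at v j                                     ≡⟨ overlapWord-periodic a x j j≤p ⟩
    at v (period + j)                          ≡⟨ sym (at-infix p v s (inside (+-monoʳ-≤ period j≤p))) ⟩
    at (p ++ v ++ s) (length p + (period + j)) ∎
    where open ≡-Reasoning

Periodic⇒overlap-prefix : ∀ p (t : Word) → 0 < p → p + p < length t → Periodic (at t) 0 p →
  ∃[ a ] ∃[ x ] ∃[ r ] t ≡ overlapWord a x ++ r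
Periodic⇒overlap-prefix p@(suc q) t@(a ∷ t′) _ 2p<t per = a , take q t′ , drop 1 z′ , (begin
  t                                       ≡⟨ sym (take++drop≡id p t) ⟩
  y ++ z                                  ≡⟨ cong (y ++_) (sym (take++drop≡id p z)) ⟩
  y ++ take p z ++ z′                     ≡⟨ cong₂ (λ y′ r → y ++ y′ ++ r) z-starts-with-y (head-tail z′ z′-nonempty) ⟩
  y ++ y ++ at z′ 0 ∷ drop 1 z′           ≡⟨ cong (λ b → y ++ y ++ b ∷ drop 1 z′) z′-starts-with-a ⟩
  (a ∷ x) ++ (a ∷ x) ++ a ∷ drop 1 z′     ≡⟨ cong (λ v → a ∷ x ++ a ∷ v) (sym (++-assoc x (a ∷ []) _)) ⟩
  a ∷ x ++ a ∷ (x ++ a ∷ []) ++ drop 1 z′ ≡⟨ cong (a ∷_) (sym (++-assoc x (a ∷ x ++ a ∷ []) _)) ⟩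
  overlapWord a x ++ drop 1 z′            ∎)
  where
  open ≡-Reasoning
  x = take q t′
  y = take p t
  z = drop p t
  z′ = drop p z
  z′-nonempty : 0 < length z′
  z′-nonempty = length-drop-≥ p z (subst (_≤ length z) (+-comm 1 p)
    (length-drop-≥ p t (subst (_≤ length t) (sym (+-suc p p)) 2p<t)))
  z-starts-with-y : take p z ≡ y
  z-starts-with-y = take-pointwise p z t (length-drop-≥ p t (<⇒≤ 2p<t)) (m+n≤o⇒m≤o p (<⇒≤ 2p<t))
    (λ i i<p → trans (at-drop p t i) (sym (per i (<⇒≤ i<p))))
  z′-starts-with-a : at z′ 0 ≡ a
  z′-starts-with-a = begin
    at z′ 0               ≡⟨ at-drop p z 0 ⟩
    at z (p + 0)          ≡⟨ at-drop p t (p + 0) ⟩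
    at t (p + (p + 0))    ≡⟨ cong (λ i → at t (p + i)) (+-identityʳ p) ⟩
    at t (p + p)          ≡⟨ sym (per p ≤-refl) ⟩
    at t p                ≡⟨ cong (at t) (sym (+-identityʳ p)) ⟩
    at t (p + 0)          ≡⟨ sym (per 0 z≤n) ⟩
    a                     ∎

Periodic-drop : ∀ s (w : Word) {p} → Periodic (at w) s p → Periodic (at (drop s w)) 0 p
Periodic-drop s w {p} per j j≤p = trans (at-drop s w j) (trans (per j j≤p) (sym (at-drop s w (p + j))))

Overlap⇒HasOverlap : ∀ {w} → Overlap w → HasOverlap w
Overlap⇒HasOverlap {w} (overlapAt s p p>0 fits per)
  with Periodic⇒overlap-prefix p (drop s w) p>0 (length-drop-≥ s w (subst (_≤ length w) (sym (+-suc s _)) fits))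
                               (Periodic-drop s w per)
... | a , x , r , eq =
  overlapWord a x , (a , x , refl) , take s w , r , trans (cong (take s w ++_) (sym eq)) (take++drop≡id s w)

Periodic-cong : ∀ {f g : ℕ → Letter} s p → (∀ i → s ≤ i → i ≤ s + (p + p) → f i ≡ g i) →
  Periodic f s p → Periodic g s p
Periodic-cong s p f≗g per j j≤p =
  trans (sym (f≗g (s + j) (m≤m+n s j) (+-monoʳ-≤ s (≤-trans j≤p (m≤n+m p p)))))
        (trans (per j j≤p) (f≗g (s + (p + j)) (m≤m+n s _) (+-monoʳ-≤ s (+-monoʳ-≤ p j≤p))))

Periodic-mirror : ∀ (f : ℕ → Letter) s p → Periodic f s p → Periodic (λ i → f (s + (p + p) ∸ i)) 0 p
Periodic-mirror f s p per j j≤p with m≤n⇒∃[o]m+o≡n j≤p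
... | e , refl = begin
  f (s + (p + p) ∸ j)          ≡⟨ cong f (trans (cong (_∸ j) (lemma₁ s j e)) (m+n∸n≡m _ j)) ⟩
  f (s + (p + e))              ≡⟨ sym (per e (m≤n+m e j)) ⟩
  f (s + e)                    ≡⟨ cong f (sym (trans (cong (_∸ (p + j)) (lemma₂ s j e)) (m+n∸n≡m (s + e) (p + j)))) ⟩
  f (s + (p + p) ∸ (p + j))    ∎
  where
  open ≡-Reasoning
  lemma₁ : ∀ s j e → s + ((j + e) + (j + e)) ≡ s + ((j + e) + e) + j
  lemma₁ = solve-∀
  lemma₂ : ∀ s j e → s + ((j + e) + (j + e)) ≡ (s + e) + ((j + e) + j)
  lemma₂ = solve-∀

Factor-trans : ∀ {u v w} → Factor u v → Factor v w → Factor u w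
Factor-trans {u} (p , s , refl) (p′ , s′ , refl) = p′ ++ p , s ++ s′ , (begin
  (p′ ++ p) ++ u ++ s ++ s′       ≡⟨ ++-assoc p′ p _ ⟩
  p′ ++ p ++ u ++ s ++ s′         ≡⟨ cong (λ x → p′ ++ p ++ x) (sym (++-assoc u s s′)) ⟩
  p′ ++ p ++ (u ++ s) ++ s′       ≡⟨ cong (p′ ++_) (sym (++-assoc p (u ++ s) s′)) ⟩
  p′ ++ (p ++ u ++ s) ++ s′       ∎)
  where open ≡-Reasoning

HasOverlap-factor : ∀ {v w} → Factor v w → HasOverlap v → HasOverlap w
HasOverlap-factor v⊑w (o , is-overlap , o⊑v) = o , is-overlap , Factor-trans o⊑v v⊑w

-- The Thue–Morse morphism

length-μ : ∀ u → length (μ u) ≡ length u + length u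
length-μ []      = refl
length-μ (a ∷ u) = cong suc (trans (cong suc (length-μ u)) (sym (+-suc (length u) (length u))))

μ-++ : ∀ x y → μ (x ++ y) ≡ μ x ++ μ y
μ-++ []      y = refl
μ-++ (a ∷ x) y = cong (λ w → a ∷ not a ∷ w) (μ-++ x y)

at-μ-even : ∀ u k → at (μ u) (k + k) ≡ at u k
at-μ-even []      zero    = refl
at-μ-even []      (suc k) = refl
at-μ-even (a ∷ u) zero    = refl
at-μ-even (a ∷ u) (suc k) = trans (cong (at (not a ∷ μ u)) (+-suc k k)) (at-μ-even u k)

at-μ-odd : ∀ u k → k < length u → at (μ u) (suc (k + k)) ≡ not (at u k)
at-μ-odd (a ∷ u) zero    _         = refl
at-μ-odd (a ∷ u) (suc k) (s≤s k<u) = trans (cong (at (μ u)) (+-suc k k)) (at-μ-odd u k k<u)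

μ-pair : ∀ u k → k + k < length (μ u) → at (μ u) (suc (k + k)) ≡ not (at (μ u) (k + k))
μ-pair u k 2k<μu = trans (at-μ-odd u k (m+m<n+n⇒m<n (subst (k + k <_) (length-μ u) 2k<μu)))
                         (cong not (sym (at-μ-even u k)))

module _ (u : Word) where
  private
    F : ℕ → Letter
    F = at (μ u)

  -- Each pair (s + j, s + j + 1) with j < p is aligned in μ(u) or has an aligned translate by p,
  -- so the window alternates up to s + p; for odd p that contradicts F (s) ≡ F (s + p).
  μ-no-odd-period : ∀ s k → let p = suc (k + k) in s + (p + p) < length (μ u) → ¬ Periodic F s p
  μ-no-odd-period s k fits per =
    not-¬ refl (trans (per 0 z≤n) (trans (cong (λ i → F (s + i)) (+-identityʳ p))
                                  (alternating-odd (λ j → F (s + j)) k alternates)))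
    where
    p = suc (k + k)
    alternates : ∀ j → j < p → F (s + suc j) ≡ not (F (s + j))
    alternates j j<p with parity (s + j)
    ... | inj₁ (i , s+j≡2i) = begin
      F (s + suc j)     ≡⟨ cong F (trans (+-suc s j) (cong suc s+j≡2i)) ⟩
      F (suc (i + i))   ≡⟨ μ-pair u i (≤-<-trans (≤-trans (≤-reflexive (sym s+j≡2i)) (+-monoʳ-≤ s j≤2p)) fits) ⟩
      not (F (i + i))   ≡⟨ cong (not ∘ F) (sym s+j≡2i) ⟩
      not (F (s + j))   ∎
      where
      open ≡-Reasoning
      j≤2p : j ≤ p + p
      j≤2p = ≤-trans (<⇒≤ j<p) (m≤m+n p p)
    ... | inj₂ (i , s+j≡2i+1) = begin
      F (s + suc j)         ≡⟨ per (suc j) j<p ⟩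
      F (s + (p + suc j))   ≡⟨ cong F (trans (cong (s +_) (+-suc p j)) (trans (+-suc s (p + j)) (cong suc shifted))) ⟩
      F (suc (m + m))       ≡⟨ μ-pair u m (<-trans (subst (_< s + (p + p)) shifted (+-monoʳ-< s (+-monoʳ-< p j<p))) fits) ⟩
      not (F (m + m))       ≡⟨ cong (not ∘ F) (sym shifted) ⟩
      not (F (s + (p + j))) ≡⟨ cong not (sym (per j (<⇒≤ j<p))) ⟩
      not (F (s + j))       ∎
      where
      open ≡-Reasoning
      m = suc (i + k)
      lemma₁ : ∀ s p j → s + (p + j) ≡ p + (s + j)
      lemma₁ = solve-∀
      lemma₂ : ∀ i k → suc (k + k) + suc (i + i) ≡ suc (i + k) + suc (i + k)
      lemma₂ = solve-∀
      shifted : s + (p + j) ≡ m + m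
      shifted = trans (lemma₁ s p j) (trans (cong (p +_) s+j≡2i+1) (lemma₂ i k))

  μ-even-period-at-even : ∀ σ π → 0 < π → let p = π + π in
    σ + σ + (p + p) < length (μ u) → Periodic F (σ + σ) p → Overlap u
  μ-even-period-at-even σ π π>0 fits per = overlapAt σ π π>0 fits′ periodic
    where
    p = π + π
    lemma : ∀ σ π → σ + σ + ((π + π) + (π + π)) ≡ (σ + (π + π)) + (σ + (π + π))
    lemma = solve-∀
    fits′ : σ + (π + π) < length u
    fits′ = m+m<n+n⇒m<n (subst₂ _<_ (lemma σ π) (length-μ u) fits)
    periodic : Periodic (at u) σ π
    periodic j j≤π = begin
      at u (σ + j)                        ≡⟨ sym (at-μ-even u (σ + j)) ⟩
      F ((σ + j) + (σ + j))               ≡⟨ cong F (lemma₁ σ j) ⟩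
      F (σ + σ + (j + j))                 ≡⟨ per (j + j) (+-mono-≤ j≤π j≤π) ⟩
      F (σ + σ + (p + (j + j)))           ≡⟨ cong F (lemma₂ σ π j) ⟩
      F ((σ + (π + j)) + (σ + (π + j)))   ≡⟨ at-μ-even u (σ + (π + j)) ⟩
      at u (σ + (π + j))                  ∎
      where
      open ≡-Reasoning
      lemma₁ : ∀ σ j → (σ + j) + (σ + j) ≡ σ + σ + (j + j)
      lemma₁ = solve-∀
      lemma₂ : ∀ σ π j → σ + σ + ((π + π) + (j + j)) ≡ (σ + (π + j)) + (σ + (π + j))
      lemma₂ = solve-∀

  -- The start can move back by one because μ(u) alternates on both aligned pairs (2σ, 2σ + 1)
  -- and (2σ + p, 2σ + p + 1).
  μ-even-period-shift : ∀ σ π → let p = π + π in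
    suc (σ + σ) + (p + p) < length (μ u) → Periodic F (suc (σ + σ)) p → Periodic F (σ + σ) p
  μ-even-period-shift σ π fits per zero _ = begin
    F (σ + σ + 0)                    ≡⟨ cong F (+-identityʳ (σ + σ)) ⟩
    F (σ + σ)                        ≡⟨ not-sym (μ-pair u σ (≤-<-trans (m≤m+n (σ + σ) _) (<-trans (n<1+n _) fits))) ⟩
    not (F (suc (σ + σ)))            ≡⟨ cong (not ∘ F) (sym (+-identityʳ _)) ⟩
    not (F (suc (σ + σ) + 0))        ≡⟨ cong not (per 0 z≤n) ⟩
    not (F (suc (σ + σ) + (p + 0)))  ≡⟨ cong (not ∘ F) (lemma₁ σ π) ⟩
    not (F (suc (κ + κ)))            ≡⟨ cong not (μ-pair u κ κ+κ<μu) ⟩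
    not (not (F (κ + κ)))            ≡⟨ not-involutive _ ⟩
    F (κ + κ)                        ≡⟨ cong F (lemma₂ σ π) ⟩
    F (σ + σ + (p + 0))              ∎
    where
    open ≡-Reasoning
    p = π + π
    κ = σ + π
    lemma₁ : ∀ σ π → suc (σ + σ) + ((π + π) + 0) ≡ suc ((σ + π) + (σ + π))
    lemma₁ = solve-∀
    lemma₂ : ∀ σ π → (σ + π) + (σ + π) ≡ σ + σ + ((π + π) + 0)
    lemma₂ = solve-∀
    κ+κ<μu : κ + κ < length (μ u)
    κ+κ<μu = ≤-<-trans (≤-trans (≤-reflexive (trans (lemma₂ σ π) (cong (σ + σ +_) (+-identityʳ p))))
                                 (+-monoʳ-≤ (σ + σ) (m≤m+n p p)))
                       (<-trans (n<1+n _) fits)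
  μ-even-period-shift σ π fits per (suc j) j<p = begin
    F (σ + σ + suc j)                ≡⟨ cong F (+-suc (σ + σ) j) ⟩
    F (suc (σ + σ) + j)              ≡⟨ per j (≤-trans (n≤1+n j) j<p) ⟩
    F (suc (σ + σ) + (π + π + j))    ≡⟨ cong F (lemma σ π j) ⟩
    F (σ + σ + (π + π + suc j))      ∎
    where
    open ≡-Reasoning
    lemma : ∀ σ π j → suc (σ + σ) + (π + π + j) ≡ σ + σ + (π + π + suc j)
    lemma = solve-∀

μ-overlap⇒overlap : ∀ u → Overlap (μ u) → Overlap u
μ-overlap⇒overlap u (overlapAt s p p>0 fits per) with parity p
... | inj₂ (k , refl)    = ⊥-elim (μ-no-odd-period u s k fits per)
... | inj₁ (zero , refl) = ⊥-elim (<-irrefl refl p>0)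
... | inj₁ (π@(suc _) , refl) with parity s
...   | inj₁ (σ , refl) = μ-even-period-at-even u σ π (s≤s z≤n) fits per
...   | inj₂ (σ , refl) = μ-even-period-at-even u σ π (s≤s z≤n) (<-trans (n<1+n _) fits)
                            (μ-even-period-shift u σ π fits per)

-- Flipping the end letters

length-flipFirst : ∀ v → length (flipFirst v) ≡ length v
length-flipFirst []      = refl
length-flipFirst (a ∷ v) = refl

length-flipLast : ∀ v → length (flipLast v) ≡ length v
length-flipLast []          = refl
length-flipLast (a ∷ [])    = refl
length-flipLast (a ∷ b ∷ v) = cong suc (length-flipLast (b ∷ v))

length-flipEnds : ∀ v → length (flipEnds v) ≡ length v
length-flipEnds v = trans (length-flipFirst (flipLast v)) (length-flipLast v)

length-flipFirst-μ : ∀ x → length (flipFirst (μ x)) ≡ length x + length x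
length-flipFirst-μ x = trans (length-flipFirst (μ x)) (length-μ x)

at-flipFirst : ∀ v i → at (flipFirst v) (suc i) ≡ at v (suc i)
at-flipFirst []      i = refl
at-flipFirst (a ∷ v) i = refl

at-flipLast : ∀ v i → suc i < length v → at (flipLast v) i ≡ at v i
at-flipLast (a ∷ [])    zero    (s≤s ())
at-flipLast (a ∷ b ∷ v) zero    _           = refl
at-flipLast (a ∷ b ∷ v) (suc i) (s≤s i+2≤v) = at-flipLast (b ∷ v) i i+2≤v

at-flipEnds-inner : ∀ v i → 0 < i → suc i < length v → at (flipEnds v) i ≡ at v i
at-flipEnds-inner v (suc i) _ i+2≤v = trans (at-flipFirst (flipLast v) i) (at-flipLast v (suc i) i+2≤v)

flipLast-++ : ∀ x d (z : Word) → flipLast (x ++ d ∷ z) ≡ x ++ flipLast (d ∷ z)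
flipLast-++ []          d z = refl
flipLast-++ (a ∷ [])    d z = refl
flipLast-++ (a ∷ b ∷ x) d z = cong (a ∷_) (flipLast-++ (b ∷ x) d z)

flipEnds-++ : ∀ c x y d (z : Word) → flipEnds ((c ∷ x) ++ y ++ d ∷ z) ≡ flipFirst (c ∷ x) ++ y ++ flipLast (d ∷ z)
flipEnds-++ c x y d z = cong flipFirst (begin
  flipLast ((c ∷ x) ++ y ++ d ∷ z)      ≡⟨ cong flipLast (sym (++-assoc (c ∷ x) y (d ∷ z))) ⟩
  flipLast (((c ∷ x) ++ y) ++ d ∷ z)    ≡⟨ flipLast-++ ((c ∷ x) ++ y) d z ⟩
  ((c ∷ x) ++ y) ++ flipLast (d ∷ z)    ≡⟨ ++-assoc (c ∷ x) y _ ⟩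
  (c ∷ x) ++ y ++ flipLast (d ∷ z)      ∎)
  where open ≡-Reasoning

flipEnds-μ-++ : ∀ x y z → 0 < length x → 0 < length z →
  flipEnds (μ (x ++ y ++ z)) ≡ flipFirst (μ x) ++ μ y ++ flipLast (μ z)
flipEnds-μ-++ (c ∷ x) y (d ∷ z) _ _ = begin
  flipEnds (μ ((c ∷ x) ++ y ++ d ∷ z))                 ≡⟨ cong flipEnds (μ-++ (c ∷ x) _) ⟩
  flipEnds (μ (c ∷ x) ++ μ (y ++ d ∷ z))               ≡⟨ cong (λ v → flipEnds (μ (c ∷ x) ++ v)) (μ-++ y (d ∷ z)) ⟩
  flipEnds (μ (c ∷ x) ++ μ y ++ μ (d ∷ z))             ≡⟨ flipEnds-++ c (not c ∷ μ x) (μ y) d (not d ∷ μ z) ⟩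
  flipFirst (μ (c ∷ x)) ++ μ y ++ flipLast (μ (d ∷ z)) ∎
  where open ≡-Reasoning

-- Overlap-freeness of flipEnds (μ u)

-- W alternates on every aligned pair (2k, 2k + 1) that avoids both ends of a word of length 2l + 2.
Alternating : (ℕ → Letter) → ℕ → Set
Alternating W l = ∀ k → 0 < k → suc (k + k) ≤ l + l → W (suc (k + k)) ≡ not (W (k + k))

-- Satisfied by the first seven letters a a ¬a a a ¬a ¬a of flipEnds (μ u) for both admissible prefixes
-- of u, and by its last seven letters read backwards.
record BoundaryRelations (W : ℕ → Letter) : Set where
  field
    w₁ : W 1 ≡ W 0
    w₂ : W 2 ≡ not (W 1)
    w₄ : W 4 ≡ W 3
    w₆ : W 6 ≡ not (W 3)

module _ (W : ℕ → Letter) (l : ℕ) (alternates : Alternating W l) (relations : BoundaryRelations W) where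
  open BoundaryRelations relations

  no-periodic-prefix : ∀ p → 0 < p → p ≤ l → ¬ Periodic W 0 p
  no-periodic-prefix p p>0 p≤l per with parity p
  ... | inj₁ (zero , refl) = <-irrefl refl p>0
  ... | inj₁ (k@(suc _) , refl) = not-¬ refl (begin
    W 0               ≡⟨ sym w₁ ⟩
    W 1               ≡⟨ per 1 p>0 ⟩
    W (p + 1)         ≡⟨ cong W (+-comm p 1) ⟩
    W (suc p)         ≡⟨ alternates k (s≤s z≤n) (≤-trans p+1≤p+p (+-mono-≤ p≤l p≤l)) ⟩
    not (W p)         ≡⟨ cong (not ∘ W) (sym (+-identityʳ p)) ⟩
    not (W (p + 0))   ≡⟨ cong not (sym (per 0 z≤n)) ⟩
    not (W 0)         ∎)
    where
    open ≡-Reasoning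
    p+1≤p+p : suc p ≤ p + p
    p+1≤p+p = subst (_≤ p + p) (+-comm p 1) (+-monoʳ-≤ p p>0)
  ... | inj₂ (zero , refl)       = not-¬ (sym (per 1 ≤-refl)) w₂
  ... | inj₂ (suc zero , refl)   = not-¬ (sym (per 3 ≤-refl)) w₆
  ... | inj₂ (k@(suc (suc _)) , refl) = not-¬ refl (begin
    W 3               ≡⟨ sym w₄ ⟩
    W 4               ≡⟨ per 4 4≤p ⟩
    W (p + 4)         ≡⟨ cong W (lemma₁ k) ⟩
    W (suc (m + m))   ≡⟨ alternates m (s≤s z≤n) 2m+1≤2l ⟩
    not (W (m + m))   ≡⟨ cong (not ∘ W) (lemma₂ k) ⟩
    not (W (p + 3))   ≡⟨ cong not (sym (per 3 (≤-trans (n≤1+n 3) 4≤p))) ⟩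
    not (W 3)         ∎)
    where
    open ≡-Reasoning
    m = suc (suc k)
    2≤k : 2 ≤ k
    2≤k = s≤s (s≤s z≤n)
    4≤p : 4 ≤ p
    4≤p = s≤s (≤-trans (n≤1+n 3) (+-mono-≤ 2≤k 2≤k))
    lemma₁ : ∀ k → suc (k + k) + 4 ≡ suc (suc (suc k) + suc (suc k))
    lemma₁ = solve-∀
    lemma₂ : ∀ k → suc (suc k) + suc (suc k) ≡ suc (k + k) + 3
    lemma₂ = solve-∀
    2m+1≤2l : suc (m + m) ≤ l + l
    2m+1≤2l = subst (_≤ l + l) (lemma₁ k) (≤-trans (+-monoʳ-≤ p 4≤p) (+-mono-≤ p≤l p≤l))

Alternating-mirror : ∀ W l → Alternating W l → Alternating (λ i → W (suc (l + l) ∸ i)) l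
Alternating-mirror W l alt k@(suc k′) _ 2k+1≤2l with m≤n⇒∃[o]m+o≡n (m+m<n+n⇒m<n {k} {l} 2k+1≤2l)
... | m , refl = begin
  W ((l + l) ∸ (k + k))           ≡⟨ cong W (trans (cong (_∸ (k + k)) (lemma₁ k′ m)) (m+n∸n≡m _ (k + k))) ⟩
  W (suc m + suc m)               ≡⟨ not-sym (alt (suc m) (s≤s z≤n) 2m+3≤2l) ⟩
  not (W (suc (suc m + suc m)))   ≡⟨ cong (not ∘ W) (sym (trans (cong (_∸ (k + k)) (lemma₂ k′ m)) (m+n∸n≡m _ (k + k)))) ⟩
  not (W (suc (l + l) ∸ (k + k))) ∎
  where
  open ≡-Reasoning
  lemma₁ : ∀ k′ m → (suc (suc k′) + m) + (suc (suc k′) + m) ≡ (suc m + suc m) + (suc k′ + suc k′)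
  lemma₁ = solve-∀
  lemma₂ : ∀ k′ m → suc ((suc (suc k′) + m) + (suc (suc k′) + m)) ≡ suc (suc m + suc m) + (suc k′ + suc k′)
  lemma₂ = solve-∀
  lemma₃ : ∀ k′ m → suc (suc m + suc m) + suc (k′ + k′) ≡ (suc (suc k′) + m) + (suc (suc k′) + m)
  lemma₃ = solve-∀
  2m+3≤2l : suc (suc m + suc m) ≤ l + l
  2m+3≤2l = subst (suc (suc m + suc m) ≤_) (lemma₃ k′ m) (m≤m+n _ _)

module _ (u : Word) (l : ℕ) (|u|≡1+l : length u ≡ suc l) where
  private
    w : Word
    w = flipEnds (μ u)

  length-μ-suc : length (μ u) ≡ suc (suc (l + l))
  length-μ-suc = trans (length-μ u) (trans (cong (λ n → n + n) |u|≡1+l) (cong suc (+-suc l l)))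

  flipEnds-μ-inner : ∀ i → 0 < i → i ≤ l + l → at w i ≡ at (μ u) i
  flipEnds-μ-inner i i>0 i≤2l = at-flipEnds-inner (μ u) i i>0 (subst (suc i <_) (sym length-μ-suc) (s≤s (s≤s i≤2l)))

  flipEnds-μ-alternating : Alternating (at w) l
  flipEnds-μ-alternating k k>0 2k<2l = begin
    at w (suc (k + k))       ≡⟨ flipEnds-μ-inner _ (s≤s z≤n) 2k<2l ⟩
    at (μ u) (suc (k + k))   ≡⟨ μ-pair u k 2k<μu ⟩
    not (at (μ u) (k + k))   ≡⟨ cong not (sym (flipEnds-μ-inner _ (≤-trans k>0 (m≤m+n k k)) (<⇒≤ 2k<2l))) ⟩
    not (at w (k + k))       ∎
    where
    open ≡-Reasoning
    2k<μu : k + k < length (μ u)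
    2k<μu = subst (k + k <_) (sym length-μ-suc) (≤-trans 2k<2l (≤-trans (n≤1+n _) (n≤1+n _)))

  flipEnds-μ-no-periodic : OverlapFree u → BoundaryRelations (at w) → BoundaryRelations (λ i → at w (suc (l + l) ∸ i)) →
    ∀ s p → 0 < p → s + (p + p) ≤ suc (l + l) → ¬ Periodic (at w) s p
  flipEnds-μ-no-periodic _ start _ zero p p>0 2p≤2l+1 =
    no-periodic-prefix (at w) l flipEnds-μ-alternating start p p>0 (m+m≤1+n+n⇒m≤n 2p≤2l+1)
  flipEnds-μ-no-periodic of _ end s@(suc _) p p>0 s+2p≤2l+1 per with m≤n⇒m<n∨m≡n s+2p≤2l+1
  ... | inj₁ s+2p<2l+1 = of (Overlap⇒HasOverlap (μ-overlap⇒overlap u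
          (overlapAt s p p>0 (subst (s + (p + p) <_) (sym length-μ-suc) (≤-trans s+2p<2l+1 (n≤1+n _)))
            (Periodic-cong s p (λ i s≤i i≤s+2p →
               flipEnds-μ-inner i (≤-trans (s≤s z≤n) s≤i) (≤-pred (≤-trans (s≤s i≤s+2p) s+2p<2l+1))) per))))
  ... | inj₂ s+2p≡2l+1 = no-periodic-prefix _ l (Alternating-mirror (at w) l flipEnds-μ-alternating) end
          p p>0 (m+m≤1+n+n⇒m≤n (m+n≤o⇒n≤o s s+2p≤2l+1))
          (subst (λ n → Periodic (λ i → at w (n ∸ i)) 0 p) s+2p≡2l+1 (Periodic-mirror (at w) s p per))

  flipEnds-μ-no-overlap : OverlapFree u → BoundaryRelations (at w) → BoundaryRelations (λ i → at w (suc (l + l) ∸ i)) →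
    ¬ Overlap w
  flipEnds-μ-no-overlap of start end (overlapAt s p p>0 fits per) =
    flipEnds-μ-no-periodic of start end s p p>0
      (≤-pred (subst (s + (p + p) <_) (trans (length-flipEnds (μ u)) length-μ-suc) fits)) per

flipEnds-μ-start-relations : ∀ u → 8 ≤ length u →
  HasPrefix (𝟎 ∷ 𝟎 ∷ 𝟏 ∷ 𝟎 ∷ []) u ⊎ HasPrefix (𝟏 ∷ 𝟏 ∷ 𝟎 ∷ 𝟏 ∷ []) u →
  BoundaryRelations (at (flipEnds (μ u)))
flipEnds-μ-start-relations _ (s≤s (s≤s (s≤s (s≤s ())))) (inj₁ ([] , refl))
flipEnds-μ-start-relations _ (s≤s (s≤s (s≤s (s≤s ())))) (inj₂ ([] , refl))
flipEnds-μ-start-relations _ _ (inj₁ (_ ∷ _ , refl)) = record { w₁ = refl ; w₂ = refl ; w₄ = refl ; w₆ = refl }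
flipEnds-μ-start-relations _ _ (inj₂ (_ ∷ _ , refl)) = record { w₁ = refl ; w₂ = refl ; w₄ = refl ; w₆ = refl }

flipEnds-μ-suffix-split : ∀ c r →
  flipEnds (μ ((c ∷ r) ++ 𝟎 ∷ 𝟏 ∷ 𝟎 ∷ 𝟎 ∷ [])) ≡ flipFirst (μ (c ∷ r)) ++ 𝟎 ∷ 𝟏 ∷ 𝟏 ∷ 𝟎 ∷ 𝟎 ∷ 𝟏 ∷ 𝟎 ∷ 𝟎 ∷ []
flipEnds-μ-suffix-split c r = flipEnds-μ-++ (c ∷ r) [] (𝟎 ∷ 𝟏 ∷ 𝟎 ∷ 𝟎 ∷ []) (s≤s z≤n) (s≤s z≤n)

flipEnds-μ-end-relations : ∀ u l → length u ≡ suc l → 8 ≤ length u → HasSuffix (𝟎 ∷ 𝟏 ∷ 𝟎 ∷ 𝟎 ∷ []) u →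
  BoundaryRelations (λ i → at (flipEnds (μ u)) (suc (l + l) ∸ i))
flipEnds-μ-end-relations _ l _ (s≤s (s≤s (s≤s (s≤s ())))) ([] , refl)
flipEnds-μ-end-relations _ l |u| _ (c ∷ r , refl) = record
  { w₁ = trans (from-end 1) (sym (from-end 0))
  ; w₂ = trans (from-end 2) (cong not (sym (from-end 1)))
  ; w₄ = trans (from-end 4) (sym (from-end 3))
  ; w₆ = trans (from-end 6) (cong not (sym (from-end 3)))
  }
  where
  open ≡-Reasoning
  w = flipEnds (μ ((c ∷ r) ++ 𝟎 ∷ 𝟏 ∷ 𝟎 ∷ 𝟎 ∷ []))
  A = flipFirst (μ (c ∷ r))
  Z = 𝟎 ∷ 𝟏 ∷ 𝟏 ∷ 𝟎 ∷ 𝟎 ∷ 𝟏 ∷ 𝟎 ∷ 𝟎 ∷ []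
  n = length (c ∷ r)
  lemma : ∀ n → suc ((n + 3) + (n + 3)) ≡ (n + n) + 7
  lemma = solve-∀
  l≡n+3 : l ≡ n + 3
  l≡n+3 = suc-injective (trans (sym |u|) (trans (length-++ (c ∷ r)) (+-suc n 3)))
  last≡A+7 : suc (l + l) ≡ length A + 7
  last≡A+7 = begin
    suc (l + l)               ≡⟨ cong (λ m → suc (m + m)) l≡n+3 ⟩
    suc ((n + 3) + (n + 3))   ≡⟨ lemma n ⟩
    (n + n) + 7               ≡⟨ cong (_+ 7) (sym (length-flipFirst-μ (c ∷ r))) ⟩
    length A + 7              ∎
  from-end : ∀ i {i≤7 : T (i ≤ᵇ 7)} → at w (suc (l + l) ∸ i) ≡ at Z (7 ∸ i)
  from-end i {i≤7} = begin
    at w (suc (l + l) ∸ i)           ≡⟨ cong (λ m → at w (m ∸ i)) last≡A+7 ⟩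
    at w (length A + 7 ∸ i)          ≡⟨ cong (at w) (+-∸-assoc (length A) (≤ᵇ⇒≤ i 7 i≤7)) ⟩
    at w (length A + (7 ∸ i))        ≡⟨ cong (λ v → at v (length A + (7 ∸ i))) (flipEnds-μ-suffix-split c r) ⟩
    at (A ++ Z) (length A + (7 ∸ i)) ≡⟨ at-++ʳ A (7 ∸ i) ⟩
    at Z (7 ∸ i)                     ∎

flipEnds-μ-overlapFree : ∀ u → 8 ≤ length u → Earmarked u → OverlapFree (flipEnds (μ u))
flipEnds-μ-overlapFree u@(_ ∷ u′) 8≤u (of , prefix , suffix) has =
  flipEnds-μ-no-overlap u (length u′) refl of (flipEnds-μ-start-relations u 8≤u prefix)
    (flipEnds-μ-end-relations u (length u′) refl 8≤u suffix) (HasOverlap⇒Overlap has)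

-- Extremality

++-split : ∀ (x y A B : Word) → x ++ y ≡ A ++ B → length A ≤ length x → ∃[ m ] (x ≡ A ++ m × m ++ y ≡ B)
++-split x       y []      B eq        _         = x , refl , eq
++-split (c ∷ x) y (d ∷ A) B eq (s≤s A≤x) with ∷-injective eq
... | refl , eq′ with ++-split x y A B eq′ A≤x
...   | m , refl , m++y≡B = m , refl , m++y≡B

split-at : ∀ m n (w : Word) → length w ≡ m + n → ∃[ x ] ∃[ y ] (w ≡ x ++ y × length x ≡ m × length y ≡ n)
split-at zero    n w       |w| = [] , w , refl , refl , |w|
split-at (suc m) n (c ∷ w) |w| with split-at m n w (suc-injective |w|)
... | x , y , refl , |x| , |y| = c ∷ x , y , refl , cong suc |x| , |y|

insert : ℕ → Letter → Word → Word
insert k a w = take k w ++ a ∷ drop k w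

insert-++ : ∀ (x y : Word) a → insert (length x) a (x ++ y) ≡ x ++ a ∷ y
insert-++ []      y a = refl
insert-++ (c ∷ x) y a = cong (c ∷_) (insert-++ x y a)

extension-in-factor : ∀ (p z s : Word) {w′ w″} a k → w′ ++ w″ ≡ p ++ z ++ s → length p + k ≡ length w′ →
  k ≤ length z → HasOverlap (insert k a z) → HasOverlap (w′ ++ a ∷ w″)
extension-in-factor p z s {w′} {w″} a k split |w′| k≤z has =
  let m , w′≡p++m , m++w″≡z++s = ++-split w′ w″ p (z ++ s) split (subst (length p ≤_) |w′| (m≤m+n _ k))
      |m|≡k = sym (+-cancelˡ-≡ (length p) _ _ (trans |w′| (trans (cong length w′≡p++m) (length-++ p))))
      n , z≡m++n , n++s≡w″ = ++-split z s m w″ (sym m++w″≡z++s) (subst (_≤ length z) (sym |m|≡k) k≤z)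
  in HasOverlap-factor (p , s , sym (begin
       w′ ++ a ∷ w″               ≡⟨ cong₂ (λ x y → x ++ a ∷ y) w′≡p++m (sym n++s≡w″) ⟩
       (p ++ m) ++ a ∷ n ++ s     ≡⟨ ++-assoc p m _ ⟩
       p ++ m ++ a ∷ n ++ s       ≡⟨ cong (p ++_) (sym (++-assoc m (a ∷ n) s)) ⟩
       p ++ (m ++ a ∷ n) ++ s     ∎))
     (subst HasOverlap (trans (cong₂ (λ i x → insert i a x) (sym |m|≡k) z≡m++n) (insert-++ m n a)) has)
  where open ≡-Reasoning

-- A sound overlap search: some suffix a ∷ r of w begins with a x a x a for a prefix x of r.
OverlapPrefix : Word → Set
OverlapPrefix []      = ⊥
OverlapPrefix (a ∷ r) = Any (λ x → Prefix _≡_ (overlapWord a x) (a ∷ r)) (inits r)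

overlapPrefix? : Decidable OverlapPrefix
overlapPrefix? []      = no id
overlapPrefix? (a ∷ r) = any? (λ x → prefix? _≟_ (overlapWord a x) (a ∷ r)) (inits r)

FoundOverlap : Word → Set
FoundOverlap w = Any OverlapPrefix (tails w)

foundOverlap? : Decidable FoundOverlap
foundOverlap? w = any? overlapPrefix? (tails w)

Prefix⇒HasPrefix : ∀ {v w : Word} → Prefix _≡_ v w → HasPrefix v w
Prefix⇒HasPrefix []           = _ , refl
Prefix⇒HasPrefix (refl ∷ v⊑w) with Prefix⇒HasPrefix v⊑w
... | r , refl = r , refl

OverlapPrefix⇒HasOverlap : ∀ w → OverlapPrefix w → HasOverlap w
OverlapPrefix⇒HasOverlap (a ∷ r) found with satisfied found
... | x , v⊑w with Prefix⇒HasPrefix v⊑w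
...   | s , eq = overlapWord a x , (a , x , refl) , [] , s , sym eq

FoundOverlap⇒HasOverlap : ∀ w → FoundOverlap w → HasOverlap w
FoundOverlap⇒HasOverlap (a ∷ r) (here found)  = OverlapPrefix⇒HasOverlap (a ∷ r) found
FoundOverlap⇒HasOverlap (a ∷ r) (there found) =
  HasOverlap-factor (a ∷ [] , [] , cong (a ∷_) (++-identityʳ r)) (FoundOverlap⇒HasOverlap r found)

ExtensionsFound : Word → ℕ → Set
ExtensionsFound z k = FoundOverlap (insert k 𝟎 z) × FoundOverlap (insert k 𝟏 z)

extensionsFound? : ∀ z → Decidable (ExtensionsFound z)
extensionsFound? z k = foundOverlap? (insert k 𝟎 z) ×-dec foundOverlap? (insert k 𝟏 z)

ExtensionsFound⇒HasOverlap : ∀ {z k} → ExtensionsFound z k → ∀ a → HasOverlap (insert k a z)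
ExtensionsFound⇒HasOverlap (found₀ , _) false = FoundOverlap⇒HasOverlap _ found₀
ExtensionsFound⇒HasOverlap (_ , found₁) true  = FoundOverlap⇒HasOverlap _ found₁

words : ℕ → List Word
words zero    = [] ∷ []
words (suc n) = map (𝟎 ∷_) (words n) ++ map (𝟏 ∷_) (words n)

∈-words : ∀ w → w ∈ words (length w)
∈-words []          = here refl
∈-words (false ∷ w) = ∈-++⁺ˡ (∈-map⁺ (𝟎 ∷_) (∈-words w))
∈-words (true ∷ w)  = ∈-++⁺ʳ (map (𝟎 ∷_) (words (length w))) (∈-map⁺ (𝟏 ∷_) (∈-words w))

StartChecks : Word → Set
StartChecks P = All (λ t → All (ExtensionsFound (flipFirst (μ (P ++ t)))) (upTo 8)) (words 3)

start-checks? : Decidable StartChecks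
start-checks? P = all? (λ t → all? (extensionsFound? (flipFirst (μ (P ++ t)))) (upTo 8)) (words 3)

EndChecks : Word → Set
EndChecks S = All (λ t → All (ExtensionsFound (flipLast (μ (t ++ S)))) (applyUpTo (6 +_) 9)) (words 3)

end-checks? : Decidable EndChecks
end-checks? S = all? (λ t → all? (extensionsFound? (flipLast (μ (t ++ S)))) (applyUpTo (6 +_) 9)) (words 3)

MiddleChecks : Set
MiddleChecks = All (λ β → All (ExtensionsFound (μ β)) (6 ∷ 7 ∷ [])) (words 7)

prefix-0010-checked : StartChecks (𝟎 ∷ 𝟎 ∷ 𝟏 ∷ 𝟎 ∷ [])
prefix-0010-checked = from-yes (start-checks? (𝟎 ∷ 𝟎 ∷ 𝟏 ∷ 𝟎 ∷ []))

prefix-1101-checked : StartChecks (𝟏 ∷ 𝟏 ∷ 𝟎 ∷ 𝟏 ∷ [])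
prefix-1101-checked = from-yes (start-checks? (𝟏 ∷ 𝟏 ∷ 𝟎 ∷ 𝟏 ∷ []))

suffix-0100-checked : EndChecks (𝟎 ∷ 𝟏 ∷ 𝟎 ∷ 𝟎 ∷ [])
suffix-0100-checked = from-yes (end-checks? (𝟎 ∷ 𝟏 ∷ 𝟎 ∷ 𝟎 ∷ []))

middle-checked : MiddleChecks
middle-checked = from-yes (all? (λ β → all? (extensionsFound? (μ β)) (6 ∷ 7 ∷ [])) (words 7))

extension-near-start : ∀ P r → length P ≡ 4 → StartChecks P → 4 ≤ length r →
  ∀ {w′ w″} a → w′ ++ w″ ≡ flipEnds (μ (P ++ r)) → length w′ ≤ 7 → HasOverlap (w′ ++ a ∷ w″)
extension-near-start P r |P| checks 4≤r {w′} a split w′≤7 with m≤n⇒∃[o]m+o≡n 4≤r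
... | o , 4+o≡r with split-at 3 (suc o) r (sym 4+o≡r)
...   | t , R , refl , |t| , |R| =
  extension-in-factor [] Z (flipLast (μ R)) a (length w′) (trans split w≡Z++) refl w′≤Z
    (ExtensionsFound⇒HasOverlap (lookup (lookup checks t∈words) (∈-upTo⁺ (s≤s w′≤7))) a)
  where
  Z = flipFirst (μ (P ++ t))
  |P++t| : length (P ++ t) ≡ 7
  |P++t| = trans (length-++ P) (cong₂ _+_ |P| |t|)
  t∈words : t ∈ words 3
  t∈words = subst (λ n → t ∈ words n) |t| (∈-words t)
  w≡Z++ : flipEnds (μ (P ++ t ++ R)) ≡ Z ++ flipLast (μ R)
  w≡Z++ = trans (cong (flipEnds ∘ μ) (sym (++-assoc P t R)))
                (flipEnds-μ-++ (P ++ t) [] R (subst (0 <_) (sym |P++t|) (s≤s z≤n)) (subst (0 <_) (sym |R|) (s≤s z≤n)))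
  w′≤Z : length w′ ≤ length Z
  w′≤Z = ≤-trans w′≤7 (subst (7 ≤_) (sym (trans (length-flipFirst-μ (P ++ t)) (cong (λ n → n + n) |P++t|))) (m≤m+n 7 7))

-- An insertion at most 8 letters before the end falls at position 6 + j of the 14-letter image of
-- the last seven letters.
end-offset : ∀ {a x y} → x + y ≡ a + 14 → y ≤ 8 → ∃[ j ] (j < 9 × a + (6 + j) ≡ x)
end-offset {a} {x} {y} x+y≡a+14 y≤8 =
  let j , a+6+j≡x = m≤n⇒∃[o]m+o≡n a+6≤x
  in j , s≤s (+-cancelˡ-≤ (a + 6) j 8 (begin
       a + 6 + j        ≤⟨ m≤m+n _ y ⟩
       a + 6 + j + y    ≡⟨ cong (_+ y) a+6+j≡x ⟩
       x + y            ≡⟨ x+y≡a+14 ⟩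
       a + 14           ≡⟨ sym (+-assoc a 6 8) ⟩
       a + 6 + 8        ∎)) , trans (sym (+-assoc a 6 j)) a+6+j≡x
  where
  open ≤-Reasoning
  a+6≤x : a + 6 ≤ x
  a+6≤x = +-cancelʳ-≤ y (a + 6) x (begin
    a + 6 + y   ≤⟨ +-monoʳ-≤ (a + 6) y≤8 ⟩
    a + 6 + 8   ≡⟨ +-assoc a 6 8 ⟩
    a + 14      ≡⟨ sym x+y≡a+14 ⟩
    x + y       ∎)

extension-near-end : ∀ r S → 4 ≤ length r → length S ≡ 4 → EndChecks S →
  ∀ {w′ w″} a → w′ ++ w″ ≡ flipEnds (μ (r ++ S)) → length w″ ≤ 8 → HasOverlap (w′ ++ a ∷ w″)
extension-near-end r S 4≤r |S| checks {w′} {w″} a split w″≤8 with m≤n⇒∃[o]m+o≡n 4≤r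
... | o , 4+o≡r with split-at (suc o) 3 r (trans (sym 4+o≡r) (cong suc (+-comm 3 o)))
...   | L , t , refl , |L| , |t| =
  let j , j<9 , A+6+j≡w′ = end-offset total w″≤8
  in extension-in-factor A Z [] a (6 + j) (trans split w≡A++Z) A+6+j≡w′
       (subst (6 + j ≤_) (sym |Z|) (+-monoʳ-≤ 6 (≤-pred j<9)))
       (ExtensionsFound⇒HasOverlap (lookup (lookup checks t∈words) (∈-applyUpTo⁺ (6 +_) j<9)) a)
  where
  A = flipFirst (μ L)
  Z = flipLast (μ (t ++ S))
  |t++S| : length (t ++ S) ≡ 7
  |t++S| = trans (length-++ t) (cong₂ _+_ |t| |S|)
  |Z| : length Z ≡ 14
  |Z| = trans (length-flipLast (μ (t ++ S))) (trans (length-μ (t ++ S)) (cong (λ n → n + n) |t++S|))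
  t∈words : t ∈ words 3
  t∈words = subst (λ n → t ∈ words n) |t| (∈-words t)
  w≡A++Z : flipEnds (μ ((L ++ t) ++ S)) ≡ A ++ Z ++ []
  w≡A++Z = trans (cong (flipEnds ∘ μ) (++-assoc L t S))
           (trans (flipEnds-μ-++ L [] (t ++ S) (subst (0 <_) (sym |L|) (s≤s z≤n)) (subst (0 <_) (sym |t++S|) (s≤s z≤n)))
                  (cong (A ++_) (sym (++-identityʳ Z))))
  total : length w′ + length w″ ≡ length A + 14
  total = trans (sym (length-++ w′)) (trans (cong length (trans split w≡A++Z))
                (trans (length-++ A) (cong (length A +_) (trans (cong length (++-identityʳ Z)) |Z|))))

extension-in-middle : ∀ u τ k → τ + 8 ≤ length u → 0 < τ → k ∈ 6 ∷ 7 ∷ [] →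
  ∀ {w′ w″} a → w′ ++ w″ ≡ flipEnds (μ u) → τ + τ + k ≡ length w′ → HasOverlap (w′ ++ a ∷ w″)
extension-in-middle u τ k τ+8≤u τ>0 k∈67 a split 2τ+k≡w′ with m≤n⇒∃[o]m+o≡n τ+8≤u
... | o , τ+8+o≡u with split-at τ (8 + o) u (trans (sym τ+8+o≡u) (+-assoc τ 8 o))
...   | L , rest , refl , |L| , |rest| with split-at 7 (suc o) rest |rest|
...     | β , R , refl , |β| , |R| =
  extension-in-factor (flipFirst (μ L)) (μ β) (flipLast (μ R)) a k
    (trans split (flipEnds-μ-++ L β R (subst (0 <_) (sym |L|) τ>0) (subst (0 <_) (sym |R|) (s≤s z≤n))))
    (trans (cong (_+ k) (trans (length-flipFirst-μ L) (cong (λ n → n + n) |L|))) 2τ+k≡w′)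
    (subst (k ≤_) (sym (trans (length-μ β) (cong (λ n → n + n) |β|))) (k≤14 k∈67))
    (ExtensionsFound⇒HasOverlap (lookup (lookup middle-checked β∈words) k∈67) a)
  where
  β∈words : β ∈ words 7
  β∈words = subst (λ n → β ∈ words n) |β| (∈-words β)
  k≤14 : k ∈ 6 ∷ 7 ∷ [] → k ≤ 14
  k≤14 (here refl)         = m≤m+n 6 8
  k≤14 (there (here refl)) = m≤m+n 7 7

middle-bound : ∀ {τ x y n} → τ + τ + 6 ≤ x → 8 < y → x + y ≡ n + n → τ + 8 ≤ n
middle-bound {τ} {x} {y} {n} 2τ+6≤x 8<y x+y≡2n =
  subst (_≤ n) (sym (+-suc τ 7)) (m+m<n+n⇒m<n (begin-strict
    (τ + 7) + (τ + 7)   ≡⟨ lemma τ ⟩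
    τ + τ + 6 + 8       <⟨ +-mono-≤-< 2τ+6≤x 8<y ⟩
    x + y               ≡⟨ x+y≡2n ⟩
    n + n               ∎))
  where
  open ≤-Reasoning
  lemma : ∀ τ → (τ + 7) + (τ + 7) ≡ τ + τ + 6 + 8
  lemma = solve-∀

middle-offset : ∀ {x y n} → 7 < x → 8 < y → x + y ≡ n + n →
  ∃[ τ ] ∃[ k ] (τ + 8 ≤ n × 0 < τ × k ∈ 6 ∷ 7 ∷ [] × τ + τ + k ≡ x)
middle-offset {x} {y} {n} 7<x 8<y x+y≡2n with m≤n⇒∃[o]m+o≡n (≤-trans (n≤1+n 6) (<⇒≤ 7<x))
... | e , 6+e≡x with parity e
...   | inj₁ (zero , refl) = ⊥-elim (<⇒≱ 7<x (≤-trans (≤-reflexive (sym 6+e≡x)) (n≤1+n 6)))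
...   | inj₂ (zero , refl) = ⊥-elim (<-irrefl 6+e≡x 7<x)
...   | inj₁ (τ@(suc _) , refl) =
  τ , 6 , middle-bound {τ} (≤-reflexive 2τ+6≡x) 8<y x+y≡2n , s≤s z≤n , here refl , 2τ+6≡x
  where
  2τ+6≡x : τ + τ + 6 ≡ x
  2τ+6≡x = trans (+-comm (τ + τ) 6) 6+e≡x
...   | inj₂ (τ@(suc _) , refl) =
  τ , 7 , middle-bound {τ} (≤-trans (+-monoʳ-≤ (τ + τ) (n≤1+n 6)) (≤-reflexive 2τ+7≡x)) 8<y x+y≡2n ,
  s≤s z≤n , there (here refl) , 2τ+7≡x
  where
  2τ+7≡x : τ + τ + 7 ≡ x
  2τ+7≡x = trans (+-comm (τ + τ) 7) (trans (sym (+-suc 6 (τ + τ))) 6+e≡x)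

flipEnds-μ-extremal : ∀ u → 8 ≤ length u → Earmarked u →
  ∀ w′ w″ a → w′ ++ w″ ≡ flipEnds (μ u) → HasOverlap (w′ ++ a ∷ w″)
flipEnds-μ-extremal u 8≤u (_ , prefix , suffix) w′ w″ a split with length w′ ≤? 7 | length w″ ≤? 8
... | yes w′≤7 | _ with prefix
...   | inj₁ (r , refl) =
  extension-near-start (𝟎 ∷ 𝟎 ∷ 𝟏 ∷ 𝟎 ∷ []) r refl prefix-0010-checked (+-cancelˡ-≤ 4 4 _ 8≤u) a split w′≤7
...   | inj₂ (r , refl) =
  extension-near-start (𝟏 ∷ 𝟏 ∷ 𝟎 ∷ 𝟏 ∷ []) r refl prefix-1101-checked (+-cancelˡ-≤ 4 4 _ 8≤u) a split w′≤7
flipEnds-μ-extremal u 8≤u (_ , _ , (r , refl)) w′ w″ a split | no _ | yes w″≤8 =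
  extension-near-end r (𝟎 ∷ 𝟏 ∷ 𝟎 ∷ 𝟎 ∷ []) (+-cancelʳ-≤ 4 4 _ (subst (8 ≤_) (length-++ r) 8≤u)) refl
    suffix-0100-checked a split w″≤8
flipEnds-μ-extremal u 8≤u _ w′ w″ a split | no w′≰7 | no w″≰8 =
  let τ , k , τ+8≤u , τ>0 , k∈67 , 2τ+k≡w′ = middle-offset (≰⇒> w′≰7) (≰⇒> w″≰8) total
  in extension-in-middle u τ k τ+8≤u τ>0 k∈67 a split 2τ+k≡w′
  where
  total : length w′ + length w″ ≡ length u + length u
  total = trans (sym (length-++ w′)) (trans (cong length split) (trans (length-flipEnds (μ u)) (length-μ u)))

flipEnds-μ-prefix : ∀ u → 8 ≤ length u →
  HasPrefix (𝟎 ∷ 𝟎 ∷ 𝟏 ∷ 𝟎 ∷ []) u ⊎ HasPrefix (𝟏 ∷ 𝟏 ∷ 𝟎 ∷ 𝟏 ∷ []) u →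
  HasPrefix (𝟎 ∷ 𝟎 ∷ 𝟏 ∷ 𝟎 ∷ []) (flipEnds (μ u)) ⊎ HasPrefix (𝟏 ∷ 𝟏 ∷ 𝟎 ∷ 𝟏 ∷ []) (flipEnds (μ u))
flipEnds-μ-prefix _ (s≤s (s≤s (s≤s (s≤s ())))) (inj₁ ([] , refl))
flipEnds-μ-prefix _ (s≤s (s≤s (s≤s (s≤s ())))) (inj₂ ([] , refl))
flipEnds-μ-prefix _ _ (inj₁ (_ ∷ _ , refl)) = inj₂ (_ , refl)
flipEnds-μ-prefix _ _ (inj₂ (_ ∷ _ , refl)) = inj₁ (_ , refl)

flipEnds-μ-suffix : ∀ u → 8 ≤ length u → HasSuffix (𝟎 ∷ 𝟏 ∷ 𝟎 ∷ 𝟎 ∷ []) u →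
  HasSuffix (𝟎 ∷ 𝟏 ∷ 𝟎 ∷ 𝟎 ∷ []) (flipEnds (μ u))
flipEnds-μ-suffix _ (s≤s (s≤s (s≤s (s≤s ())))) ([] , refl)
flipEnds-μ-suffix _ _ (c ∷ r , refl) =
  flipFirst (μ (c ∷ r)) ++ 𝟎 ∷ 𝟏 ∷ 𝟏 ∷ 𝟎 ∷ [] ,
  trans (flipEnds-μ-suffix-split c r) (sym (++-assoc (flipFirst (μ (c ∷ r))) _ _))

lemma2p3 : ∀ (u : Word) → 8 ≤ length u → Earmarked u →
    Earmarked (flipEnds (μ u)) × ExtremalOverlapFree (flipEnds (μ u))
lemma2p3 u 8≤u earmarked@(_ , prefix , suffix) =
  (overlapFree , flipEnds-μ-prefix u 8≤u prefix , flipEnds-μ-suffix u 8≤u suffix) ,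
  (overlapFree , flipEnds-μ-extremal u 8≤u earmarked)
  where
  overlapFree : OverlapFree (flipEnds (μ u))
  overlapFree = flipEnds-μ-overlapFree u 8≤u earmarked
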